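{- Let $n\geq 2$ be a fixed integer, and for any prime $q$ let $\pi(q)$ denote the (least) period of the sequence $(s_k(n)\bmod q)_k$. Then $\pi(2)=3$ if and only if $n$ is odd, in which case $s_k(n)$ is even if and only if $k\equiv 1\pmod 3$; while if $n$ is even then $\pi(2)=1$ and all $s_k(n)$ are odd. Moreover, for $q$ an odd prime, one of the following three possibilities occurs: (i) $\left(\frac{n^2-4}{q}\right)=\pm1$ and $\pi(q)$ divides $q\mp 1$ (respectively); (ii) $n\equiv 2\pmod q$, $\pi(q)=q$, and $s_k(n)\equiv 0\pmod q$ if and only if $q\mid 2k+1$; (iii) $n\equiv -2\pmod q$, $\pi(q)=2$, and $s_k(n)\equiv(-1)^k\pmod q$.
   Context: For an integer $n$, the sequence $(s_k(n))_{k\in\mathbb{Z}}$ is defined by $s_0(n)=1$, $s_1(n)=n+1$ and $s_{k+2}(n)=n\,s_{k+1}(n)-s_k(n)$ for all $k\in\mathbb{Z}$. $\left(\frac{\cdot}{q}\right)$ denotes the Legendre symbol. -}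

module Defs where

open import Data.Nat as ℕ using (ℕ; zero; suc)
open import Data.Integer using (ℤ; +_; -_; _+_; _-_; _*_; _^_; ∣_∣; -[1+_]; 0ℤ; 1ℤ; -1ℤ; _≤_; _<_)
open import Data.Integer.Divisibility using (_∣_)
open import Data.Product using (Σ; _×_)
open import Relation.Nullary using (¬_)

-- Backward part: v k = s_{-k}(n); v 0 = 1, v 1 = s_{-1} = n*1 - (n+1) = -1,
-- and v (k+2) = s_{-k-2} = n s_{-k-1} - s_{-k} = n v (k+1) - v k.
sPos : ℤ → ℕ → ℤ
sPos n zero = + 1
sPos n (suc zero) = n + + 1
sPos n (suc (suc k)) = n * sPos n (suc k) - sPos n k

sNeg : ℤ → ℕ → ℤ
sNeg n zero = + 1
sNeg n (suc zero) = -1ℤ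
sNeg n (suc (suc k)) = n * sNeg n (suc k) - sNeg n k

s : ℤ → ℤ → ℤ
s (+ k) n = sPos n k
s -[1+ k ] n = sNeg n (suc k)

infix 4 _≡_[mod_]
_≡_[mod_] : ℤ → ℤ → ℕ → Set
a ≡ b [mod q ] = (+ q) ∣ (a - b)

IsPeriod : ℤ → ℕ → ℕ → Set
IsPeriod n q p = (0 ℕ.< p) × (∀ (k : ℤ) → s (k + + p) n ≡ s k n [mod q ])

LeastPeriod : ℤ → ℕ → ℕ → Set
LeastPeriod n q p = IsPeriod n q p × (∀ p′ → IsPeriod n q p′ → p ℕ.≤ p′)

data Legendre (a : ℤ) (q : ℕ) : ℤ → Set where
  divisible : (+ q) ∣ a → Legendre a q 0ℤ
  residue   : ¬ ((+ q) ∣ a) → Σ ℤ (λ x → x * x ≡ a [mod q ]) → Legendre a q 1ℤ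
  nonres    : ¬ ((+ q) ∣ a) → (∀ x → ¬ (x * x ≡ a [mod q ])) → Legendre a q -1ℤ

negOnePow : ℤ → ℤ
negOnePow k = -1ℤ ^ ∣ k ∣

{-# OPTIONS --safe #-}

-- Let ξ be a root of x² − n x + 1 in ℤ[ξ] = ℤ[x]/(x² − n x + 1). If ξ^m = a + b ξ then
-- s_{k+m} = a s_k + b s_{k+1}, so every m with ξ^m ≡ 1 (mod q) is a period of (s_k mod q).
-- For an odd prime q write q = 2m + 1 and D = n² − 4. In ℤ[ξ]/q we have 2ξ = n + δ with
-- δ² = D, and the Frobenius map (characteristic q) gives 2 ξ^q = n + δ D^m. If D is a
-- nonzero square then D^m ≡ 1, hence ξ^q = ξ and ξ^(q−1) = 1; if D is not a square then
-- D^m ≡ −1 by Euler's criterion (proved from Lagrange's bound on the number of roots of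
-- x^m − 1), hence ξ^q = n − ξ = ξ⁻¹ and ξ^(q+1) = 1. The least period divides every period.
-- If q ∣ D then n ≡ ±2 and the recurrence is solved explicitly by 2k + 1, resp. (−1)^k.
-- Modulo 2 the sequence is constantly 1 for even n, and runs through 1, 0, 1 for odd n.

module Submission where

open import Level using (0ℓ)
open import Algebra.Bundles using (CommutativeRing)
open import Algebra.Core using (Op₁; Op₂)
open import Algebra.Definitions using (Congruent₁; Congruent₂)
open import Algebra.Structures using (IsCommutativeRing)
open import Data.Nat as ℕ using (ℕ; zero; suc; z≤n; s≤s; _!; _∸_)
import Data.Nat.Properties as ℕ
import Data.Nat.Divisibility as ℕ
open import Data.Nat.DivMod using (_%_; _/_; m%n<n; m≡m%n+[m/n]*n; m/n*n≡m)
open import Data.Nat.Combinatorics using (_C_; nCk≡n!/k![n-k]!; k![n∸k]!∣n!; nCn≡1)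
open import Data.Nat.Primality using (Prime; euclidsLemma; prime⇒irreducible; prime⇒nonTrivial; prime⇒nonZero)
open import Data.Fin as Fin using (Fin; toℕ; inject₁; fromℕ; fromℕ<)
open import Data.Fin.Properties using (any?; toℕ-inject₁; toℕ-fromℕ; toℕ-fromℕ<; toℕ<n)
open import Data.Product using (_,_)
open import Data.Sum as Sum using (_⊎_; inj₁; inj₂)
open import Data.Empty using (⊥-elim)
open import Function.Base using (_∘_)
open import Relation.Binary.Core using (Rel)
open import Relation.Binary.Structures using (IsEquivalence)
open import Relation.Binary.PropositionalEquality as ≡ using (_≡_; _≢_; refl)
open import Relation.Nullary using (¬_; Dec; yes; no)

-- Binomial coefficients modulo a prime

n∣n! : ∀ {n} → 0 ℕ.< n → n ℕ.∣ n !
n∣n! {suc n} _ = ℕ.m∣m*n (n !)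

module _ {q : ℕ} (prime : Prime q) where

  1<q : 1 ℕ.< q
  1<q = ℕ.nonTrivial⇒n>1 q {{prime⇒nonTrivial prime}}

  q∤m! : ∀ {m} → m ℕ.< q → ¬ (q ℕ.∣ m !)
  q∤m! {zero} _ q∣1 = ℕ.nonTrivial⇒≢1 {{prime⇒nonTrivial prime}} (ℕ.∣1⇒≡1 q∣1)
  q∤m! {suc m} m<q q∣m! with euclidsLemma (suc m) (m !) prime q∣m!
  ... | inj₁ q∣1+m = ℕ.>⇒∤ m<q q∣1+m
  ... | inj₂ q∣m!  = q∤m! (ℕ.<-trans (ℕ.n<1+n m) m<q) q∣m!

  q∣qCk : ∀ {k} → 0 ℕ.< k → k ℕ.< q → q ℕ.∣ q C k
  q∣qCk {k} 0<k k<q with euclidsLemma (q C k) (k ! ℕ.* (q ∸ k) !) prime q∣qCk*k![q∸k]!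
    where
    instance _ = ℕ._!*_!≢0 k (q ∸ k)
    qCk*k![q∸k]!≡q! : (q C k) ℕ.* (k ! ℕ.* (q ∸ k) !) ≡ q !
    qCk*k![q∸k]!≡q! = ≡.trans (≡.cong (ℕ._* (k ! ℕ.* (q ∸ k) !)) (nCk≡n!/k![n-k]! (ℕ.<⇒≤ k<q)))
                              (m/n*n≡m (k![n∸k]!∣n! (ℕ.<⇒≤ k<q)))
    q∣qCk*k![q∸k]! : q ℕ.∣ (q C k) ℕ.* (k ! ℕ.* (q ∸ k) !)
    q∣qCk*k![q∸k]! = ≡.subst (q ℕ.∣_) (≡.sym qCk*k![q∸k]!≡q!) (n∣n! (ℕ.<-trans (s≤s z≤n) 1<q))
  ... | inj₁ q∣qCk = q∣qCk
  ... | inj₂ q∣k![q∸k]! with euclidsLemma (k !) ((q ∸ k) !) prime q∣k![q∸k]!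
  ...   | inj₁ q∣k!     = ⊥-elim (q∤m! k<q q∣k!)
  ...   | inj₂ q∣[q∸k]! = ⊥-elim (q∤m! (ℕ.∸-monoʳ-< {q} {k} {0} 0<k (ℕ.<⇒≤ k<q)) q∣[q∸k]!)

-- Quotient rings and the Frobenius map

module Quotient
  {A : Set} {_+_ _*_ : Op₂ A} { -_ : Op₁ A} {0# 1# : A}
  (isCommutativeRing : IsCommutativeRing _≡_ _+_ _*_ -_ 0# 1#)
  {_∼_ : Rel A 0ℓ} (isEquivalence : IsEquivalence _∼_)
  (+-cong : Congruent₂ _∼_ _+_) (*-cong : Congruent₂ _∼_ _*_) (-‿cong : Congruent₁ _∼_ -_)
  where

  private
    module R = IsCommutativeRing isCommutativeRing
    open IsEquivalence isEquivalence using (reflexive)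

  quotientRing : CommutativeRing 0ℓ 0ℓ
  quotientRing = record
    { isCommutativeRing = record
      { isRing = record
        { +-isAbelianGroup = record
          { isGroup = record
            { isMonoid = record
              { isSemigroup = record
                { isMagma = record { isEquivalence = isEquivalence ; ∙-cong = +-cong }
                ; assoc = λ x y z → reflexive (R.+-assoc x y z)
                }
              ; identity = (λ x → reflexive (R.+-identityˡ x)) , (λ x → reflexive (R.+-identityʳ x))
              }
            ; inverse = (λ x → reflexive (R.-‿inverseˡ x)) , (λ x → reflexive (R.-‿inverseʳ x))
            ; ⁻¹-cong = -‿cong
            }
          ; comm = λ x y → reflexive (R.+-comm x y)
          }
        ; *-cong = *-cong
        ; *-assoc = λ x y z → reflexive (R.*-assoc x y z)
        ; *-identity = (λ x → reflexive (R.*-identityˡ x)) , (λ x → reflexive (R.*-identityʳ x))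
        ; distrib = (λ x y z → reflexive (R.distribˡ x y z)) , (λ x y z → reflexive (R.distribʳ x y z))
        }
      ; *-comm = λ x y → reflexive (R.*-comm x y)
      }
    }

  private
    open import Algebra.Properties.Semiring.Exp (CommutativeRing.semiring quotientRing)
      using () renaming (_^_ to _^ᵠ_)
    base : CommutativeRing 0ℓ 0ℓ
    base = record { isCommutativeRing = isCommutativeRing }
  open import Algebra.Properties.Semiring.Exp (CommutativeRing.semiring base) using (_^_)

  ^-≡ : ∀ x k → x ^ᵠ k ≡ x ^ k
  ^-≡ x zero    = refl
  ^-≡ x (suc k) = ≡.cong (x *_) (^-≡ x k)

module Frobenius {c ℓ} (R : CommutativeRing c ℓ) {q : ℕ} (prime : Prime q) where

  open CommutativeRing R renaming (refl to ≈-refl)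
  open import Algebra.Properties.Ring ring using (+-inverseʳ-unique)
  open import Algebra.Properties.Semiring.Mult semiring using (_×_; ×-congʳ; ×-congˡ; ×-assocˡ; ×-assoc-*)
  open import Algebra.Properties.Semiring.Exp semiring using (_^_; ^-congʳ; ^-congˡ)
  open import Algebra.Properties.Semiring.Sum semiring using (sum; sum-cong-≋; sum-init-last; sum-replicate-zero)
  open import Algebra.Properties.CommutativeSemiring.Binomial commutativeSemiring
    using (theorem; binomialTerm)
  open import Relation.Binary.Reasoning.Setoid setoid

  module _ (char : q × 1# ≈ 0#) where

    q×≈0 : ∀ x → q × x ≈ 0#
    q×≈0 x = begin
      q × x          ≈⟨ ×-congʳ q (*-identityˡ x) ⟨
      q × (1# * x)   ≈⟨ ×-assoc-* q 1# x ⟨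
      (q × 1#) * x   ≈⟨ *-congʳ char ⟩
      0# * x         ≈⟨ zeroˡ x ⟩
      0#             ∎

    qCk×≈0 : ∀ {k} z → 0 ℕ.< k → k ℕ.< q → (q C k) × z ≈ 0#
    qCk×≈0 {k} z 0<k k<q with q∣qCk prime 0<k k<q
    ... | ℕ.divides c qCk≡c*q = begin
      (q C k) × z      ≈⟨ ×-congˡ (≡.trans qCk≡c*q (ℕ.*-comm c q)) ⟩
      (q ℕ.* c) × z    ≈⟨ ×-assocˡ z q c ⟨
      q × (c × z)      ≈⟨ q×≈0 _ ⟩
      0#               ∎

    -- Only the two outer terms of the binomial expansion survive.
    frobenius : ∀ x y → (x + y) ^ q ≈ x ^ q + y ^ q
    frobenius x y = expand (ℕ.suc-pred q {{prime⇒nonZero prime}})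
      where
      expand : ∀ {p} → suc p ≡ q → (x + y) ^ q ≈ x ^ q + y ^ q
      expand {p} refl = begin
        (x + y) ^ q                                                       ≈⟨ theorem q x y ⟩
        t Fin.zero + sum (λ i → t (Fin.suc i))                            ≈⟨ +-congˡ (sum-init-last (λ i → t (Fin.suc i))) ⟩
        t Fin.zero + (sum (λ i → t (Fin.suc (inject₁ i))) + t (Fin.suc (fromℕ p)))
                                                                          ≈⟨ +-congˡ (+-congʳ middle≈0) ⟩
        t Fin.zero + (0# + t (Fin.suc (fromℕ p)))                         ≈⟨ +-congˡ (+-identityˡ _) ⟩
        t Fin.zero + t (Fin.suc (fromℕ p))                                ≈⟨ +-comm _ _ ⟩
        t (Fin.suc (fromℕ p)) + t Fin.zero                                ≈⟨ +-cong last≈ first≈ ⟩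
        x ^ q + y ^ q                                                     ∎
        where
        t : Fin (suc q) → Carrier
        t = binomialTerm x y q
        middle≈0 : sum (λ i → t (Fin.suc (inject₁ i))) ≈ 0#
        middle≈0 = trans (sum-cong-≋ λ i → qCk×≈0 _ (s≤s z≤n) (s≤s (≡.subst (ℕ._< p) (≡.sym (toℕ-inject₁ i)) (toℕ<n i))))
                         (sum-replicate-zero p)
        first≈ : t Fin.zero ≈ y ^ q
        first≈ = trans (+-identityʳ _) (*-identityˡ _)
        last≈ : t (Fin.suc (fromℕ p)) ≈ x ^ q
        last≈ = lastTerm (≡.cong suc (toℕ-fromℕ p))
          where
          lastTerm : ∀ {k} → k ≡ q → (q C k) × (x ^ k * y ^ (q ∸ k)) ≈ x ^ q
          lastTerm refl = begin
            (q C q) × (x ^ q * y ^ (q ∸ q))    ≈⟨ ×-congˡ (nCn≡1 q) ⟩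
            1 × (x ^ q * y ^ (q ∸ q))          ≈⟨ +-identityʳ _ ⟩
            x ^ q * y ^ (q ∸ q)                ≈⟨ *-congˡ (^-congʳ y (ℕ.n∸n≡0 q)) ⟩
            x ^ q * 1#                         ≈⟨ *-identityʳ _ ⟩
            x ^ q                              ∎

    0^q≈0 : 0# ^ q ≈ 0#
    0^q≈0 = ≡.subst (λ k → 0# ^ k ≈ 0#) (ℕ.suc-pred q {{prime⇒nonZero prime}}) (zeroˡ _)

    1^≈1 : ∀ k → 1# ^ k ≈ 1#
    1^≈1 zero    = ≈-refl
    1^≈1 (suc k) = trans (*-identityˡ _) (1^≈1 k)

    frobenius-neg : ∀ x → (- x) ^ q ≈ - (x ^ q)
    frobenius-neg x = +-inverseʳ-unique (x ^ q) ((- x) ^ q) (begin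
      x ^ q + (- x) ^ q   ≈⟨ frobenius x (- x) ⟨
      (x + - x) ^ q       ≈⟨ ^-congˡ q (-‿inverseʳ x) ⟩
      0# ^ q              ≈⟨ 0^q≈0 ⟩
      0#                  ∎)

    frobenius-×1 : ∀ k → (k × 1#) ^ q ≈ k × 1#
    frobenius-×1 zero    = 0^q≈0
    frobenius-×1 (suc k) = begin
      (1# + k × 1#) ^ q        ≈⟨ frobenius 1# (k × 1#) ⟩
      1# ^ q + (k × 1#) ^ q    ≈⟨ +-cong (1^≈1 q) (frobenius-×1 k) ⟩
      1# + k × 1#              ∎

open import Defs
open import Data.Integer using (ℤ; +_; -_; _+_; _-_; _*_; _^_; ∣_∣; -[1+_]; 0ℤ; 1ℤ; -1ℤ; _≤_)
import Data.Integer.Properties as ℤₚ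
open import Data.Integer.DivMod using (_%ℕ_; _/ℕ_; a≡a%ℕn+[a/ℕn]*n; n%ℕd<d)
import Data.Integer.Divisibility as Unsigned
open import Data.Integer.Divisibility.Signed
  using (_∣_; divides; ∣ᵤ⇒∣; ∣⇒∣ᵤ; ∣m∣n⇒∣m+n; ∣m⇒∣-m; ∣n⇒∣m*n; ∣-refl)
open import Data.Integer.Tactic.RingSolver using (solve-∀)
open import Data.Product using (Σ; ∃; _×_; proj₁; proj₂)
open import Function.Bundles using (_⇔_; mk⇔; Equivalence)
open import Relation.Nullary.Decidable using (_×-dec_; map′)


-- Congruence modulo q as a record, so that a, b and q can be inferred from a proof.
infix 4 _≋_[_]
record _≋_[_] (a b : ℤ) (q : ℕ) : Set where
  constructor mod⁺
  field mod⁻ : + q ∣ a - b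
open _≋_[_] public

fromMod : ∀ {q a b} → a ≡ b [mod q ] → a ≋ b [ q ]
fromMod = mod⁺ ∘ ∣ᵤ⇒∣

toMod : ∀ {q a b} → a ≋ b [ q ] → a ≡ b [mod q ]
toMod = ∣⇒∣ᵤ ∘ mod⁻

module _ {q : ℕ} where

  ∣-resp-≡ : ∀ {a b} → a ≡ b → + q ∣ a → + q ∣ b
  ∣-resp-≡ = ≡.subst (+ q ∣_)

  ∣⇒≋0 : ∀ {a} → + q ∣ a → a ≋ 0ℤ [ q ]
  ∣⇒≋0 {a} = mod⁺ ∘ ∣-resp-≡ (≡.sym (ℤₚ.+-identityʳ a))

  ≋0⇒∣ : ∀ {a} → a ≋ 0ℤ [ q ] → + q ∣ a
  ≋0⇒∣ {a} = ∣-resp-≡ (ℤₚ.+-identityʳ a) ∘ mod⁻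

  ≋-reflexive : ∀ {a b} → a ≡ b → a ≋ b [ q ]
  ≋-reflexive {a} refl = mod⁺ (∣-resp-≡ (≡.sym (ℤₚ.+-inverseʳ a)) (divides 0ℤ refl))

  ≋-refl : ∀ {a} → a ≋ a [ q ]
  ≋-refl = ≋-reflexive refl

  ≋-sym : ∀ {a b} → a ≋ b [ q ] → b ≋ a [ q ]
  ≋-sym {a} {b} (mod⁺ d) = mod⁺ (∣-resp-≡ (eq a b) (∣m⇒∣-m d))
    where eq : ∀ a b → - (a - b) ≡ b - a
          eq = solve-∀

  ≋-trans : ∀ {a b c} → a ≋ b [ q ] → b ≋ c [ q ] → a ≋ c [ q ]
  ≋-trans {a} {b} {c} (mod⁺ d) (mod⁺ e) = mod⁺ (∣-resp-≡ (eq a b c) (∣m∣n⇒∣m+n d e))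
    where eq : ∀ a b c → (a - b) + (b - c) ≡ a - c
          eq = solve-∀

  ≋-isEquivalence : IsEquivalence (λ a b → a ≋ b [ q ])
  ≋-isEquivalence = record { refl = ≋-refl ; sym = ≋-sym ; trans = ≋-trans }

  +-cong-≋ : Congruent₂ (λ a b → a ≋ b [ q ]) _+_
  +-cong-≋ {a} {b} {c} {d} (mod⁺ d₁) (mod⁺ d₂) = mod⁺ (∣-resp-≡ (eq a b c d) (∣m∣n⇒∣m+n d₁ d₂))
    where eq : ∀ a b c d → (a - b) + (c - d) ≡ (a + c) - (b + d)
          eq = solve-∀

  *-cong-≋ : Congruent₂ (λ a b → a ≋ b [ q ]) _*_
  *-cong-≋ {a} {b} {c} {d} (mod⁺ d₁) (mod⁺ d₂) =
    mod⁺ (∣-resp-≡ (eq a b c d) (∣m∣n⇒∣m+n (∣n⇒∣m*n c d₁) (∣n⇒∣m*n b d₂)))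
    where eq : ∀ a b c d → c * (a - b) + b * (c - d) ≡ a * c - b * d
          eq = solve-∀

  -‿cong-≋ : Congruent₁ (λ a b → a ≋ b [ q ]) (-_)
  -‿cong-≋ {a} {b} (mod⁺ d) = mod⁺ (∣-resp-≡ (eq a b) (∣m⇒∣-m d))
    where eq : ∀ a b → - (a - b) ≡ - a - - b
          eq = solve-∀

  ∣q* : ∀ a → + q ∣ + q * a
  ∣q* a = divides a (ℤₚ.*-comm (+ q) a)

≋-%ℕ : ∀ {q} .{{_ : ℕ.NonZero q}} a → a ≋ + (a %ℕ q) [ q ]
≋-%ℕ {q} a = mod⁺ (divides (a /ℕ q) (difference (+ (a %ℕ q)) (a /ℕ q) (a≡a%ℕn+[a/ℕn]*n a q)))
  where
  difference : ∀ {a} r t → a ≡ r + t * + q → a - r ≡ t * + q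
  difference r t refl = eq r t (+ q)
    where eq : ∀ r t x → r + t * x - r ≡ t * x
          eq = solve-∀

ℤ/_ : ℕ → CommutativeRing 0ℓ 0ℓ
ℤ/ q = Quotient.quotientRing ℤₚ.+-*-isCommutativeRing (≋-isEquivalence {q}) +-cong-≋ *-cong-≋ -‿cong-≋

0<k<q⇒q∤k : ∀ {q k} → 0 ℕ.< k → k ℕ.< q → ¬ (+ q ∣ + k)
0<k<q⇒q∤k 0<k k<q = ℕ.>⇒∤ {{ℕ.>-nonZero 0<k}} k<q ∘ ∣⇒∣ᵤ

module _ {q : ℕ} (prime : Prime q) where

  ∤1 : ¬ (+ q ∣ 1ℤ)
  ∤1 = 0<k<q⇒q∤k (s≤s z≤n) (1<q prime)

  ∣-*⇒∣⊎∣ : ∀ a b → + q ∣ a * b → (+ q ∣ a) ⊎ (+ q ∣ b)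
  ∣-*⇒∣⊎∣ a b q∣ab =
    Sum.map ∣ᵤ⇒∣ ∣ᵤ⇒∣ (euclidsLemma ∣ a ∣ ∣ b ∣ prime (≡.subst (q ℕ.∣_) (ℤₚ.abs-* a b) (∣⇒∣ᵤ q∣ab)))

  *-cancelˡ-≋ : ∀ c {a b} → ¬ (+ q ∣ c) → c * a ≋ c * b [ q ] → a ≋ b [ q ]
  *-cancelˡ-≋ c {a} {b} q∤c (mod⁺ d) with ∣-*⇒∣⊎∣ c (a - b) (∣-resp-≡ (eq c a b) d)
    where eq : ∀ c a b → c * a - c * b ≡ c * (a - b)
          eq = solve-∀
  ... | inj₁ q∣c = ⊥-elim (q∤c q∣c)
  ... | inj₂ q∣a-b = mod⁺ q∣a-b

  square≋1⇒≋±1 : ∀ x → x * x ≋ 1ℤ [ q ] → x ≋ 1ℤ [ q ] ⊎ x ≋ -1ℤ [ q ]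
  square≋1⇒≋±1 x (mod⁺ d) =
    Sum.map mod⁺ (mod⁺ ∘ ∣-resp-≡ (eq₂ x)) (∣-*⇒∣⊎∣ (x - 1ℤ) (x + 1ℤ) (∣-resp-≡ (eq₁ x) d))
    where eq₁ : ∀ x → x * x - 1ℤ ≡ (x - 1ℤ) * (x + 1ℤ)
          eq₁ = solve-∀
          eq₂ : ∀ x → x + 1ℤ ≡ x - -1ℤ
          eq₂ = solve-∀


module Fermat {q : ℕ} (prime : Prime q) where

  private
    open CommutativeRing (ℤ/ q) using (semiring; setoid)
    open import Algebra.Properties.Semiring.Mult semiring using () renaming (_×_ to _×′_)
    open import Algebra.Properties.Semiring.Exp semiring using () renaming (_^_ to _^′_)
    open import Relation.Binary.Reasoning.Setoid setoid

    ×′1≡ : ∀ k → k ×′ 1ℤ ≡ + k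
    ×′1≡ zero    = refl
    ×′1≡ (suc k) = ≡.cong (_+_ 1ℤ) (×′1≡ k)

    ^′≡^ : ∀ x k → x ^′ k ≡ x ^ k
    ^′≡^ x zero    = refl
    ^′≡^ x (suc k) = ≡.cong (x *_) (^′≡^ x k)

    char : q ×′ 1ℤ ≋ 0ℤ [ q ]
    char = ≋-trans (≋-reflexive (×′1≡ q)) (∣⇒≋0 ∣-refl)

    open Frobenius (ℤ/ q) prime using (frobenius-×1; frobenius-neg)

  fermat : ∀ a → a ^ q ≋ a [ q ]
  fermat (+ k) = begin
    (+ k) ^ q            ≡⟨ ≡.cong (_^ q) (×′1≡ k) ⟨
    (k ×′ 1ℤ) ^ q        ≡⟨ ^′≡^ (k ×′ 1ℤ) q ⟨
    (k ×′ 1ℤ) ^′ q       ≈⟨ frobenius-×1 char k ⟩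
    k ×′ 1ℤ              ≡⟨ ×′1≡ k ⟩
    + k                  ∎
  fermat -[1+ k ] = begin
    (- + suc k) ^ q      ≡⟨ ^′≡^ (- + suc k) q ⟨
    (- + suc k) ^′ q     ≈⟨ frobenius-neg char (+ suc k) ⟩
    - ((+ suc k) ^′ q)   ≡⟨ ≡.cong -_ (^′≡^ (+ suc k) q) ⟩
    - ((+ suc k) ^ q)    ≈⟨ -‿cong-≋ (fermat (+ suc k)) ⟩
    - + suc k            ∎

  fermat-little : ∀ a → ¬ (+ q ∣ a) → a ^ ℕ.pred q ≋ 1ℤ [ q ]
  fermat-little a q∤a = *-cancelˡ-≋ prime a q∤a (begin
    a * a ^ ℕ.pred q   ≡⟨ ≡.cong (a ^_) (ℕ.suc-pred q {{prime⇒nonZero prime}}) ⟩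
    a ^ q              ≈⟨ fermat a ⟩
    a                  ≡⟨ ℤₚ.*-identityʳ a ⟨
    a * 1ℤ             ∎)

^-cong-≋ : ∀ {q a b} k → a ≋ b [ q ] → a ^ k ≋ b ^ k [ q ]
^-cong-≋ zero    _   = ≋-refl
^-cong-≋ (suc k) a≋b = *-cong-≋ a≋b (^-cong-≋ k a≋b)

-- Polynomial functions and Euler's criterion

-- A polynomial function of degree at most d, described by its divided differences:
-- f x - f r = (x - r) g x with g of degree at most d - 1.
Degree≤ : ℕ → (ℤ → ℤ) → Set
Degree≤ zero    f = ∀ x y → f x ≡ f y
Degree≤ (suc d) f = ∀ r → ∃ λ g → Degree≤ d g × (∀ x → f x - f r ≡ (x - r) * g x)

degree≤-const : ∀ d c → Degree≤ d (λ _ → c)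
degree≤-const zero    c _ _ = refl
degree≤-const (suc d) c r   = (λ _ → 0ℤ) , degree≤-const d 0ℤ , λ x → eq c (x - r)
  where eq : ∀ c u → c - c ≡ u * 0ℤ
        eq = solve-∀

degree≤-suc : ∀ d {f} → Degree≤ d f → Degree≤ (suc d) f
degree≤-suc zero {f} const r = (λ _ → 0ℤ) , (λ _ _ → refl) , λ x →
  ≡.trans (≡.cong (_- f r) (const x r)) (eq (f r) (x - r))
  where eq : ∀ c u → c - c ≡ u * 0ℤ
        eq = solve-∀
degree≤-suc (suc d) deg r with deg r
... | g , deg-g , diff = g , degree≤-suc d deg-g , diff

degree≤-+ : ∀ d {f g} → Degree≤ d f → Degree≤ d g → Degree≤ d (λ x → f x + g x)
degree≤-+ zero deg-f deg-g x y = ≡.cong₂ _+_ (deg-f x y) (deg-g x y)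
degree≤-+ (suc d) {f} {g} deg-f deg-g r with deg-f r | deg-g r
... | F , deg-F , diff-f | G , deg-G , diff-g = (λ x → F x + G x) , degree≤-+ d deg-F deg-G , λ x →
  ≡.trans (eq₁ (f x) (f r) (g x) (g r)) (≡.trans (≡.cong₂ _+_ (diff-f x) (diff-g x)) (eq₂ (x - r) (F x) (G x)))
  where eq₁ : ∀ a b c d → (a + c) - (b + d) ≡ (a - b) + (c - d)
        eq₁ = solve-∀
        eq₂ : ∀ u a b → u * a + u * b ≡ u * (a + b)
        eq₂ = solve-∀

degree≤-*ˡ : ∀ d c {f} → Degree≤ d f → Degree≤ d (λ x → c * f x)
degree≤-*ˡ zero c deg-f x y = ≡.cong (c *_) (deg-f x y)
degree≤-*ˡ (suc d) c {f} deg-f r with deg-f r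
... | F , deg-F , diff = (λ x → c * F x) , degree≤-*ˡ d c deg-F , λ x →
  ≡.trans (eq₁ c (f x) (f r)) (≡.trans (≡.cong (c *_) (diff x)) (eq₂ c (x - r) (F x)))
  where eq₁ : ∀ c a b → c * a - c * b ≡ c * (a - b)
        eq₁ = solve-∀
        eq₂ : ∀ c u a → c * (u * a) ≡ u * (c * a)
        eq₂ = solve-∀

degree≤-x* : ∀ d {f} → Degree≤ d f → Degree≤ (suc d) (λ x → x * f x)
degree≤-x* zero {f} const r = f , const , λ x →
  ≡.trans (≡.cong (λ c → x * f x - r * c) (const r x)) (eq x r (f x))
  where eq : ∀ x r a → x * a - r * a ≡ (x - r) * a
        eq = solve-∀
degree≤-x* (suc d) {f} deg-f r with deg-f r
... | F , deg-F , diff =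
  (λ x → f x + r * F x) , degree≤-+ (suc d) {f} {λ x → r * F x} deg-f (degree≤-suc d (degree≤-*ˡ d r deg-F)) , λ x →
  ≡.trans (eq₁ x r (f x) (f r)) (≡.trans (≡.cong (λ c → (x - r) * f x + r * c) (diff x)) (eq₂ x r (f x) (F x)))
  where eq₁ : ∀ x r a b → x * a - r * b ≡ (x - r) * a + r * (a - b)
        eq₁ = solve-∀
        eq₂ : ∀ x r a c → (x - r) * a + r * ((x - r) * c) ≡ (x - r) * (a + r * c)
        eq₂ = solve-∀

degree≤-^ : ∀ d → Degree≤ d (_^ d)
degree≤-^ zero    _ _ = refl
degree≤-^ (suc d) = degree≤-x* d (degree≤-^ d)

module _ {q : ℕ} (prime : Prime q) where

  degree≤-roots⇒≋0 : ∀ d {f} → Degree≤ d f → (r : ℕ → ℤ) →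
    (∀ i → i ℕ.≤ d → f (r i) ≋ 0ℤ [ q ]) →
    (∀ i j → i ℕ.≤ d → j ℕ.≤ d → i ≢ j → ¬ (r i ≋ r j [ q ])) →
    ∀ x → f x ≋ 0ℤ [ q ]
  degree≤-roots⇒≋0 zero const r roots _ x = ≋-trans (≋-reflexive (const x (r 0))) (roots 0 z≤n)
  degree≤-roots⇒≋0 (suc d) {f} deg r roots distinct x with deg (r 0)
  ... | g , deg-g , diff = begin
    f x                              ≡⟨ eq₁ (f x) (f (r 0)) ⟩
    f (r 0) + (f x - f (r 0))        ≡⟨ ≡.cong (_+_ (f (r 0))) (diff x) ⟩
    f (r 0) + (x - r 0) * g x        ≈⟨ +-cong-≋ (roots 0 z≤n) (*-cong-≋ (≋-refl {a = x - r 0}) g-vanishes) ⟩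
    0ℤ + (x - r 0) * 0ℤ              ≡⟨ eq₂ (x - r 0) ⟩
    0ℤ                               ∎
    where
    open import Relation.Binary.Reasoning.Setoid (CommutativeRing.setoid (ℤ/ q))
    eq₁ : ∀ a b → a ≡ b + (a - b)
    eq₁ = solve-∀
    eq₂ : ∀ u → 0ℤ + u * 0ℤ ≡ 0ℤ
    eq₂ = solve-∀
    g-roots : ∀ i → i ℕ.≤ d → g (r (suc i)) ≋ 0ℤ [ q ]
    g-roots i i≤d = *-cancelˡ-≋ prime (r (suc i) - r 0)
      (λ q∣ → distinct (suc i) 0 (s≤s i≤d) z≤n (λ ()) (mod⁺ q∣))
      (begin
        (r (suc i) - r 0) * g (r (suc i))   ≡⟨ diff (r (suc i)) ⟨
        f (r (suc i)) - f (r 0)             ≈⟨ +-cong-≋ (roots (suc i) (s≤s i≤d)) (-‿cong-≋ (roots 0 z≤n)) ⟩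
        0ℤ - 0ℤ                             ≡⟨ ℤₚ.*-zeroʳ (r (suc i) - r 0) ⟨
        (r (suc i) - r 0) * 0ℤ              ∎)
    g-vanishes : g x ≋ 0ℤ [ q ]
    g-vanishes = degree≤-roots⇒≋0 d deg-g (r ∘ suc) g-roots
      (λ i j i≤d j≤d i≢j → distinct (suc i) (suc j) (s≤s i≤d) (s≤s j≤d) (i≢j ∘ ℕ.suc-injective)) x

∣∧<⇒≡0 : ∀ {q k} → q ℕ.∣ k → k ℕ.< q → k ≡ 0
∣∧<⇒≡0 {k = zero}  _   _   = refl
∣∧<⇒≡0 {k = suc k} q∣k k<q = ⊥-elim (ℕ.>⇒∤ k<q q∣k)

private
  ≤-residue-injective : ∀ {q a b} → a ℕ.≤ b → b ℕ.< q → + b ≋ + a [ q ] → a ≡ b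
  ≤-residue-injective {q} {a} {b} a≤b b<q (mod⁺ q∣b-a) =
    ℕ.≤-antisym a≤b (ℕ.m∸n≡0⇒m≤n (∣∧<⇒≡0 q∣b∸a (ℕ.≤-<-trans (ℕ.m∸n≤m b a) b<q)))
    where q∣b∸a : q ℕ.∣ b ℕ.∸ a
          q∣b∸a = ∣⇒∣ᵤ (∣-resp-≡ (≡.trans (ℤₚ.m-n≡m⊖n b a) (ℤₚ.⊖-≥ a≤b)) q∣b-a)

residue-injective : ∀ {q a b} → a ℕ.< q → b ℕ.< q → + a ≋ + b [ q ] → a ≡ b
residue-injective {a = a} {b} a<q b<q a≋b with ℕ.≤-total a b
... | inj₁ a≤b = ≤-residue-injective a≤b b<q (≋-sym a≋b)
... | inj₂ b≤a = ≡.sym (≤-residue-injective b≤a a<q a≋b)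

module _ {m : ℕ} (prime : Prime (suc (2 ℕ.* m))) where

  0<m : 0 ℕ.< m
  0<m = positive m (1<q prime)
    where positive : ∀ k → 1 ℕ.< suc (2 ℕ.* k) → 0 ℕ.< k
          positive zero    (s≤s ())
          positive (suc k) _ = s≤s z≤n

  2<q : 2 ℕ.< suc (2 ℕ.* m)
  2<q = s≤s (ℕ.*-monoʳ-≤ 2 0<m)

module Euler {m : ℕ} (prime : Prime (suc (2 ℕ.* m))) where

  private
    q : ℕ
    q = suc (2 ℕ.* m)

    m<q : m ℕ.< q
    m<q = s≤s (ℕ.m≤m+n m _)

  0^m≡0 : 0ℤ ^ m ≡ 0ℤ
  0^m≡0 = ≡.subst (λ k → 0ℤ ^ k ≡ 0ℤ) (ℕ.suc-pred m {{ℕ.>-nonZero (0<m {m} prime)}}) refl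

  square^m≋1 : ∀ y → ¬ (+ q ∣ y) → (y * y) ^ m ≋ 1ℤ [ q ]
  square^m≋1 y q∤y = ≋-trans (≋-reflexive [y*y]^m≡y^[2m]) (Fermat.fermat-little prime y q∤y)
    where [y*y]^m≡y^[2m] : (y * y) ^ m ≡ y ^ (2 ℕ.* m)
          [y*y]^m≡y^[2m] = ≡.trans (≡.cong (λ z → (y * z) ^ m) (≡.sym (ℤₚ.*-identityʳ y))) (ℤₚ.^-*-assoc y 2 m)

  private
    squares-distinct : ∀ {a b} → 0 ℕ.< a → a ℕ.≤ m → b ℕ.≤ m → a ≢ b → ¬ (+ a * + a ≋ + b * + b [ q ])
    squares-distinct {a} {b} 0<a a≤m b≤m a≢b (mod⁺ d)
      with ∣-*⇒∣⊎∣ prime (+ a - + b) (+ a + + b) (∣-resp-≡ (eq (+ a) (+ b)) d)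
      where eq : ∀ x y → x * x - y * y ≡ (x - y) * (x + y)
            eq = solve-∀
    ... | inj₁ q∣a-b = a≢b (residue-injective (ℕ.≤-<-trans a≤m m<q) (ℕ.≤-<-trans b≤m m<q) (mod⁺ q∣a-b))
    ... | inj₂ q∣a+b = 0<k<q⇒q∤k (ℕ.<-≤-trans 0<a (ℕ.m≤m+n a b)) (s≤s a+b≤2m) q∣a+b
      where a+b≤2m : a ℕ.+ b ℕ.≤ 2 ℕ.* m
            a+b≤2m = ℕ.≤-trans (ℕ.+-mono-≤ a≤m b≤m) (ℕ.≤-reflexive (≡.cong (m ℕ.+_) (≡.sym (ℕ.+-identityʳ m))))

  module _ (D : ℤ) (nonresidue : ∀ x → ¬ (x * x ≋ D [ q ])) where

    private
      -- If D ^ m ≋ 1, then x ^ m - 1 would have the m + 1 roots 1², …, m², D.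
      root : ℕ → ℤ
      root i with i ℕ.≟ m
      ... | yes _ = D
      ... | no  _ = + suc i * + suc i

      D^m≉1 : ¬ (D ^ m ≋ 1ℤ [ q ])
      D^m≉1 D^m≋1 = ∤1 prime (∣m⇒∣-m (≋0⇒∣ -1≋0))
        where
        roots : ∀ i → i ℕ.≤ m → root i ^ m - 1ℤ ≋ 0ℤ [ q ]
        roots i i≤m with i ℕ.≟ m
        ... | yes _  = +-cong-≋ D^m≋1 ≋-refl
        ... | no i≢m =
          +-cong-≋ (square^m≋1 (+ suc i) (0<k<q⇒q∤k (s≤s z≤n) (ℕ.≤-<-trans (ℕ.≤∧≢⇒< i≤m i≢m) m<q))) ≋-refl
        distinct : ∀ i j → i ℕ.≤ m → j ℕ.≤ m → i ≢ j → ¬ (root i ≋ root j [ q ])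
        distinct i j i≤m j≤m i≢j with i ℕ.≟ m | j ℕ.≟ m
        ... | yes i≡m | yes j≡m = ⊥-elim (i≢j (≡.trans i≡m (≡.sym j≡m)))
        ... | yes _   | no _    = nonresidue (+ suc j) ∘ ≋-sym
        ... | no _    | yes _   = nonresidue (+ suc i)
        ... | no i≢m  | no j≢m  =
          squares-distinct (s≤s z≤n) (ℕ.≤∧≢⇒< i≤m i≢m) (ℕ.≤∧≢⇒< j≤m j≢m) (i≢j ∘ ℕ.suc-injective)
        -1≋0 : -1ℤ ≋ 0ℤ [ q ]
        -1≋0 = ≋-trans (≋-reflexive (≡.cong (_- 1ℤ) (≡.sym 0^m≡0)))
                 (degree≤-roots⇒≋0 prime m (degree≤-+ m (degree≤-^ m) (degree≤-const m -1ℤ)) root roots distinct 0ℤ)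

      D^m*D^m≋1 : D ^ m * D ^ m ≋ 1ℤ [ q ]
      D^m*D^m≋1 = ≋-trans (≋-reflexive D^m*D^m≡D^[2m]) (Fermat.fermat-little prime D q∤D)
        where
        D^m*D^m≡D^[2m] : D ^ m * D ^ m ≡ D ^ (2 ℕ.* m)
        D^m*D^m≡D^[2m] =
          ≡.trans (≡.sym (ℤₚ.^-distribˡ-+-* D m m)) (≡.cong (D ^_) (≡.cong (m ℕ.+_) (≡.sym (ℕ.+-identityʳ m))))
        q∤D : ¬ (+ q ∣ D)
        q∤D q∣D = nonresidue 0ℤ (≋-sym (∣⇒≋0 q∣D))

    euler-nonresidue : D ^ m ≋ -1ℤ [ q ]
    euler-nonresidue =
      Sum.[ (λ D^m≋1 → ⊥-elim (D^m≉1 D^m≋1)) , (λ D^m≋-1 → D^m≋-1) ] (square≋1⇒≋±1 prime (D ^ m) D^m*D^m≋1)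

-- Linear recurrences and their periods

s-rec : ∀ n k → s (+ 2 + k) n ≡ n * s (+ 1 + k) n - s k n
s-rec n (+ k)                    = refl
s-rec n -[1+ 0 ]                 = eq n
  where eq : ∀ n → n + 1ℤ ≡ n * 1ℤ - -1ℤ
        eq = solve-∀
s-rec n -[1+ 1 ]                 = eq n
  where eq : ∀ n → 1ℤ ≡ n * -1ℤ - (n * -1ℤ - 1ℤ)
        eq = solve-∀
s-rec n -[1+ suc (suc k) ]       = eq n (sNeg n (suc k)) (sNeg n (suc (suc k)))
  where eq : ∀ n a b → a ≡ n * b - (n * b - a)
        eq = solve-∀

private
  +2+-[1+suc] : ∀ j → + 2 + -[1+ suc j ] ≡ + 1 + -[1+ j ]
  +2+-[1+suc] zero    = refl
  +2+-[1+suc] (suc j) = refl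

module _ {q : ℕ} (c : ℤ) where

  -- The shift is written on the left, + 1 + k, so that it reduces on non-negative k.
  Recurrent : (ℤ → ℤ) → Set
  Recurrent f = ∀ k → f (+ 2 + k) ≋ c * f (+ 1 + k) - f k [ q ]

  recurrent-unique : ∀ {f g} → Recurrent f → Recurrent g →
    f 0ℤ ≋ g 0ℤ [ q ] → f 1ℤ ≋ g 1ℤ [ q ] → ∀ k → f k ≋ g k [ q ]
  recurrent-unique {f} {g} rec-f rec-g f0≋g0 f1≋g1 = agree
    where
    step : ∀ {a b a′ b′} → a ≋ a′ [ q ] → b ≋ b′ [ q ] → c * b - a ≋ c * b′ - a′ [ q ]
    step a≋a′ b≋b′ = +-cong-≋ (*-cong-≋ (≋-refl {a = c}) b≋b′) (-‿cong-≋ a≋a′)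
    back : ∀ {h} → Recurrent h → ∀ k → h k ≋ c * h (+ 1 + k) - h (+ 2 + k) [ q ]
    back {h} rec-h k = ≋-trans (≋-reflexive (eq (h k) (c * h (+ 1 + k))))
                                (+-cong-≋ (≋-refl {a = c * h (+ 1 + k)}) (-‿cong-≋ (≋-sym (rec-h k))))
      where eq : ∀ a b → a ≡ b - (b - a)
            eq = solve-∀
    forward : ∀ i → f (+ i) ≋ g (+ i) [ q ] × f (+ suc i) ≋ g (+ suc i) [ q ]
    forward zero    = f0≋g0 , f1≋g1
    forward (suc i) with forward i
    ... | fi≋gi , fi+1≋gi+1 = fi+1≋gi+1 , ≋-trans (rec-f (+ i)) (≋-trans (step fi≋gi fi+1≋gi+1) (≋-sym (rec-g (+ i))))
    backward : ∀ j → f -[1+ j ] ≋ g -[1+ j ] [ q ] × f (+ 1 + -[1+ j ]) ≋ g (+ 1 + -[1+ j ]) [ q ]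
    backward zero    = ≋-trans (back rec-f -[1+ 0 ]) (≋-trans (step f1≋g1 f0≋g0) (≋-sym (back rec-g -[1+ 0 ]))) , f0≋g0
    backward (suc j) with backward j
    ... | fj≋gj , fj+1≋gj+1 =
      ≋-trans (back rec-f -[1+ suc j ]) (≋-trans (step fj+2≋gj+2 fj≋gj) (≋-sym (back rec-g -[1+ suc j ]))) , fj≋gj
      where fj+2≋gj+2 : f (+ 2 + -[1+ suc j ]) ≋ g (+ 2 + -[1+ suc j ]) [ q ]
            fj+2≋gj+2 = ≡.subst (λ i → f i ≋ g i [ q ]) (≡.sym (+2+-[1+suc] j)) fj+1≋gj+1
    agree : ∀ k → f k ≋ g k [ q ]
    agree (+ i)     = proj₁ (forward i)
    agree -[1+ j ]  = proj₁ (backward j)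

s-recurrent : ∀ {q n c} → n ≋ c [ q ] → Recurrent c (λ k → s k n)
s-recurrent {n = n} n≋c k = ≋-trans (≋-reflexive (s-rec n k)) (+-cong-≋ (*-cong-≋ n≋c ≋-refl) ≋-refl)

Periodic : ℕ → (ℤ → ℤ) → ℕ → Set
Periodic q f p = ∀ k → f (k + + p) ≋ f k [ q ]

module _ {q : ℕ} {f : ℤ → ℤ} where

  recurrent-periodic : ∀ {c p} → Recurrent c f → f (+ p) ≋ f 0ℤ [ q ] → f (+ suc p) ≋ f 1ℤ [ q ] → Periodic q f p
  recurrent-periodic {c} {p} rec-f = recurrent-unique c shifted-rec rec-f
    where
    shifted-rec : Recurrent c (λ k → f (k + + p))
    shifted-rec k = ≡.subst₂ (λ i j → f i ≋ c * f j - f (k + + p) [ q ])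
      (≡.sym (ℤₚ.+-assoc (+ 2) k (+ p))) (≡.sym (ℤₚ.+-assoc (+ 1) k (+ p))) (rec-f (k + + p))

  periodic-* : ∀ {p} → Periodic q f p → ∀ t → Periodic q f (t ℕ.* p)
  periodic-* per zero    k = ≋-reflexive (≡.cong f (ℤₚ.+-identityʳ k))
  periodic-* {p} per (suc t) k = ≡.subst (λ i → f i ≋ f k [ q ]) (ℤₚ.+-assoc k (+ p) (+ (t ℕ.* p)))
    (≋-trans (periodic-* per t (k + + p)) (per k))

  periodic-% : ∀ {p P} .{{_ : ℕ.NonZero p}} → Periodic q f p → Periodic q f P → Periodic q f (P % p)
  periodic-% {p} {P} per-p per-P k =
    ≋-trans (≋-sym (periodic-* per-p (P / p) (k + + (P % p)))) (≋-trans (≋-reflexive (≡.cong f k+P)) (per-P k))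
    where k+P : k + + (P % p) + + (P / p ℕ.* p) ≡ k + + P
          k+P = ≡.trans (ℤₚ.+-assoc k (+ (P % p)) (+ (P / p ℕ.* p))) (≡.cong (λ i → k + + i) (≡.sym (m≡m%n+[m/n]*n P p)))

periodic-ℤ* : ∀ {q f p} → Periodic q f p → ∀ t k → f (k + t * + p) ≋ f k [ q ]
periodic-ℤ* {q} {f} {p} per (+ u) k = ≡.subst (λ i → f (k + i) ≋ f k [ q ]) (ℤₚ.pos-* u p) (periodic-* per u k)
periodic-ℤ* {q} {f} {p} per -[1+ u ] k = ≋-sym (≡.subst (λ i → f i ≋ f j [ q ]) j+[1+u]p≡k (periodic-* per (suc u) j))
  where
  j : ℤ
  j = k + -[1+ u ] * + p
  j+[1+u]p≡k : j + + (suc u ℕ.* p) ≡ k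
  j+[1+u]p≡k = ≡.trans (≡.cong (_+_ j) (ℤₚ.pos-* (suc u) p)) (eq k (+ suc u) (+ p))
    where eq : ∀ k a b → k + - a * b + a * b ≡ k
          eq = solve-∀

≋-dec : ∀ q a b → Dec (a ≋ b [ q ])
≋-dec q a b = map′ (mod⁺ ∘ ∣ᵤ⇒∣) (∣⇒∣ᵤ ∘ mod⁻) (q ℕ.∣? ∣ a - b ∣)

least-witness : ∀ {P : ℕ → Set} → (∀ i → Dec (P i)) →
  ∀ {N} → P N → ∃ λ m → P m × (∀ j → P j → m ℕ.≤ j)
least-witness P? {zero} P0 = 0 , P0 , λ _ _ → z≤n
least-witness {P} P? {suc N} PN with P? 0
... | yes P0 = 0 , P0 , λ _ _ → z≤n
... | no ¬P0 with least-witness (P? ∘ suc) PN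
...   | m , Pm , least = suc m , Pm , λ where
        zero    P0  → ⊥-elim (¬P0 P0)
        (suc j) Pj  → s≤s (least j Pj)

module _ {n : ℤ} {q : ℕ} where

  private
    sₙ : ℤ → ℤ
    sₙ k = s k n

  isPeriod⇒periodic : ∀ {p} → IsPeriod n q p → Periodic q sₙ p
  isPeriod⇒periodic (_ , per) = fromMod ∘ per

  periodic⇒isPeriod : ∀ {p} → 0 ℕ.< p → Periodic q sₙ p → IsPeriod n q p
  periodic⇒isPeriod 0<p per = 0<p , toMod ∘ per

  least-period-exists : ∀ {P} → 0 ℕ.< P → Periodic q sₙ P → ∃ (LeastPeriod n q)
  least-period-exists {P} 0<P per with least-witness returns? (0<P , per 0ℤ , per 1ℤ)
    where
    Returns : ℕ → Set
    Returns p = 0 ℕ.< p × sₙ (+ p) ≋ sₙ 0ℤ [ q ] × sₙ (+ suc p) ≋ sₙ 1ℤ [ q ]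
    returns? : ∀ p → Dec (Returns p)
    returns? p = (0 ℕ.<? p) ×-dec ≋-dec q _ _ ×-dec ≋-dec q _ _
  ... | L , (0<L , L-returns₀ , L-returns₁) , least =
    L , periodic⇒isPeriod 0<L (recurrent-periodic {c = n} (s-recurrent ≋-refl) L-returns₀ L-returns₁) ,
    λ p (0<p , per-p) → least p (0<p , fromMod (per-p 0ℤ) , fromMod (per-p 1ℤ))

  least-period-∣ : ∀ {L P} → LeastPeriod n q L → Periodic q sₙ P → L ℕ.∣ P
  least-period-∣ {L} {P} (period@(0<L , _) , least) per-P = ℕ.m%n≡0⇒n∣m P L P%L≡0
    where
    instance _ = ℕ.>-nonZero 0<L
    per-P%L : Periodic q sₙ (P % L)
    per-P%L = periodic-% (isPeriod⇒periodic period) per-P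
    P%L≡0 : P % L ≡ 0
    P%L≡0 with P % L in eq
    ... | zero  = refl
    ... | suc r = ⊥-elim (ℕ.<⇒≱ (≡.subst (ℕ._< L) eq (m%n<n P L))
                                 (least (suc r) (periodic⇒isPeriod (s≤s z≤n) (≡.subst (Periodic q sₙ) eq per-P%L))))

-- The prime 2

module Parity (n : ℤ) where

  private
    2∤1 : ¬ (+ 2 ∣ 1ℤ)
    2∤1 = 0<k<q⇒q∤k (s≤s z≤n) (s≤s (s≤s z≤n))

    3∤1 : ¬ (+ 3 ∣ 1ℤ)
    3∤1 = 0<k<q⇒q∤k (s≤s z≤n) (s≤s (s≤s z≤n))

    -1≋1 : -1ℤ ≋ 1ℤ [ 2 ]
    -1≋1 = mod⁺ (∣m⇒∣-m ∣-refl)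

  module Even (2∣n : + 2 ∣ n) where

    s≋1 : ∀ k → s k n ≋ 1ℤ [ 2 ]
    s≋1 = recurrent-unique 0ℤ (s-recurrent (∣⇒≋0 2∣n)) (λ _ → mod⁺ ∣-refl) ≋-refl (+-cong-≋ (∣⇒≋0 2∣n) ≋-refl)

    least-period-1 : LeastPeriod n 2 1
    least-period-1 = periodic⇒isPeriod (s≤s z≤n) (λ k → ≋-trans (s≋1 (k + + 1)) (≋-sym (s≋1 k))) , λ _ (0<p , _) → 0<p

    2∤s : ∀ k → ¬ (+ 2 ∣ s k n)
    2∤s k 2∣sk = 2∤1 (≋0⇒∣ (≋-trans (≋-sym (s≋1 k)) (∣⇒≋0 2∣sk)))

  module Odd (2∤n : ¬ (+ 2 ∣ n)) where

    n≋1 : n ≋ 1ℤ [ 2 ]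
    n≋1 with n %ℕ 2 | n%ℕd<d n 2 | ≋-%ℕ {2} n
    ... | zero        | _             | n≋0 = ⊥-elim (2∤n (≋0⇒∣ n≋0))
    ... | suc zero    | _             | n≋1 = n≋1
    ... | suc (suc _) | s≤s (s≤s ())  | _

    s₁≋0 : s 1ℤ n ≋ 0ℤ [ 2 ]
    s₁≋0 = ≋-trans (+-cong-≋ n≋1 ≋-refl) (∣⇒≋0 ∣-refl)

    s₂≋1 : s (+ 2) n ≋ 1ℤ [ 2 ]
    s₂≋1 = ≋-trans (+-cong-≋ (*-cong-≋ n≋1 s₁≋0) ≋-refl) -1≋1

    s₃≋1 : s (+ 3) n ≋ 1ℤ [ 2 ]
    s₃≋1 = +-cong-≋ (*-cong-≋ n≋1 s₂≋1) (-‿cong-≋ s₁≋0)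

    s₄≋0 : s (+ 4) n ≋ 0ℤ [ 2 ]
    s₄≋0 = +-cong-≋ (*-cong-≋ n≋1 s₃≋1) (-‿cong-≋ s₂≋1)

    periodic-3 : Periodic 2 (λ k → s k n) 3
    periodic-3 = recurrent-periodic {c = n} (s-recurrent ≋-refl) s₃≋1 (≋-trans s₄≋0 (≋-sym s₁≋0))

    least-period-3 : LeastPeriod n 2 3
    least-period-3 = periodic⇒isPeriod (s≤s z≤n) periodic-3 , least
      where
      least : ∀ p → IsPeriod n 2 p → 3 ℕ.≤ p
      least zero                (() , _)
      least (suc zero)          (_ , per) = ⊥-elim (2∤1 (≋0⇒∣ (≋-trans (≋-sym (fromMod (per 0ℤ))) s₁≋0)))
      least (suc (suc zero))    (_ , per) =
        ⊥-elim (2∤1 (∣m⇒∣-m {m = -1ℤ} (≋0⇒∣ (≋-trans (≋-sym (fromMod (per -1ℤ))) s₁≋0))))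
      least (suc (suc (suc _))) _         = s≤s (s≤s (s≤s z≤n))

    2∣s⇔≡1[3] : ∀ k → (+ 2 ∣ s k n) ⇔ (k ≋ 1ℤ [ 3 ])
    2∣s⇔≡1[3] k = by-residue (k %ℕ 3) (n%ℕd<d k 3) s≋s[k%3] (≋-%ℕ k)
      where
      s≋s[k%3] : s k n ≋ s (+ (k %ℕ 3)) n [ 2 ]
      s≋s[k%3] = ≡.subst (λ i → s i n ≋ s (+ (k %ℕ 3)) n [ 2 ]) (≡.sym (a≡a%ℕn+[a/ℕn]*n k 3))
                   (periodic-ℤ* periodic-3 (k /ℕ 3) (+ (k %ℕ 3)))
      by-residue : ∀ r → r ℕ.< 3 → s k n ≋ s (+ r) n [ 2 ] → k ≋ + r [ 3 ] → (+ 2 ∣ s k n) ⇔ (k ≋ 1ℤ [ 3 ])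
      by-residue 0 _ sk≋s₀ k≋0 =
        mk⇔ (λ 2∣sk → ⊥-elim (2∤1 (≋0⇒∣ (≋-trans (≋-sym sk≋s₀) (∣⇒≋0 2∣sk)))))
            (λ k≋1 → ⊥-elim (3∤1 (∣m⇒∣-m {m = -1ℤ} (mod⁻ (≋-trans (≋-sym k≋0) k≋1)))))
      by-residue 1 _ sk≋s₁ k≋1 =
        mk⇔ (λ _ → k≋1) (λ _ → ≋0⇒∣ (≋-trans sk≋s₁ s₁≋0))
      by-residue 2 _ sk≋s₂ k≋2 =
        mk⇔ (λ 2∣sk → ⊥-elim (2∤1 (≋0⇒∣ (≋-trans (≋-sym (≋-trans sk≋s₂ s₂≋1)) (∣⇒≋0 2∣sk)))))
            (λ k≋1 → ⊥-elim (3∤1 (mod⁻ (≋-trans (≋-sym k≋2) k≋1))))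
      by-residue (suc (suc (suc _))) (s≤s (s≤s (s≤s ()))) _ _

  parity : (LeastPeriod n 2 3 ⇔ (¬ ((+ 2) Unsigned.∣ n)))
         × (¬ ((+ 2) Unsigned.∣ n) → ∀ k → ((+ 2) Unsigned.∣ s k n ⇔ k ≡ + 1 [mod 3 ]))
         × ((+ 2) Unsigned.∣ n → LeastPeriod n 2 1 × (∀ k → ¬ ((+ 2) Unsigned.∣ s k n)))
  parity =
    mk⇔ (λ (_ , least) 2∣n → ℕ.<⇒≱ (s≤s (s≤s z≤n)) (least 1 (proj₁ (Even.least-period-1 (∣ᵤ⇒∣ 2∣n)))))
        (λ 2∤n → Odd.least-period-3 (2∤n ∘ ∣⇒∣ᵤ)) ,
    (λ 2∤n k → let open Odd (2∤n ∘ ∣⇒∣ᵤ) in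
      mk⇔ (toMod ∘ Equivalence.to (2∣s⇔≡1[3] k) ∘ ∣ᵤ⇒∣) (∣⇒∣ᵤ ∘ Equivalence.from (2∣s⇔≡1[3] k) ∘ fromMod)) ,
    (λ 2∣n → Even.least-period-1 (∣ᵤ⇒∣ 2∣n) , λ k → Even.2∤s (∣ᵤ⇒∣ 2∣n) k ∘ ∣ᵤ⇒∣)

-- The ring ℤ[ξ] and powers of ξ modulo q

record ℤ[ξ] : Set where
  constructor ⟨_,_⟩
  field c₀ c₁ : ℤ
open ℤ[ξ] public

⟨⟩-≡ : ∀ {a b c d} → a ≡ c → b ≡ d → ⟨ a , b ⟩ ≡ ⟨ c , d ⟩
⟨⟩-≡ = ≡.cong₂ ⟨_,_⟩

infix 4 _≋ξ_[_]
record _≋ξ_[_] (u v : ℤ[ξ]) (q : ℕ) : Set where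
  constructor _,_
  field c₀-≋ : c₀ u ≋ c₀ v [ q ]
        c₁-≋ : c₁ u ≋ c₁ v [ q ]
open _≋ξ_[_] public

-- ⟨ a , b ⟩ stands for a + b ξ, where ξ is a root of x² - n x + 1.
module Quadratic (n : ℤ) where

  infixl 6 _⊕_
  infixl 7 _⊗_

  _⊕_ _⊗_ : ℤ[ξ] → ℤ[ξ] → ℤ[ξ]
  ⟨ a , b ⟩ ⊕ ⟨ c , d ⟩ = ⟨ a + c , b + d ⟩
  ⟨ a , b ⟩ ⊗ ⟨ c , d ⟩ = ⟨ a * c - b * d , a * d + b * c + n * b * d ⟩

  ⊖_ : ℤ[ξ] → ℤ[ξ]
  ⊖ ⟨ a , b ⟩ = ⟨ - a , - b ⟩

  𝟘 𝟙 ξ : ℤ[ξ]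
  𝟘 = ⟨ 0ℤ , 0ℤ ⟩
  𝟙 = ⟨ 1ℤ , 0ℤ ⟩
  ξ = ⟨ 0ℤ , 1ℤ ⟩

  isCommutativeRing : IsCommutativeRing _≡_ _⊕_ _⊗_ ⊖_ 𝟘 𝟙
  isCommutativeRing = record
    { isRing = record
      { +-isAbelianGroup = record
        { isGroup = record
          { isMonoid = record
            { isSemigroup = record
              { isMagma = record { isEquivalence = ≡.isEquivalence ; ∙-cong = ≡.cong₂ _⊕_ }
              ; assoc = λ { ⟨ a , b ⟩ ⟨ c , d ⟩ ⟨ e , f ⟩ → ⟨⟩-≡ (ℤₚ.+-assoc a c e) (ℤₚ.+-assoc b d f) }
              }
            ; identity = (λ { ⟨ a , b ⟩ → ⟨⟩-≡ (ℤₚ.+-identityˡ a) (ℤₚ.+-identityˡ b) })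
                       , (λ { ⟨ a , b ⟩ → ⟨⟩-≡ (ℤₚ.+-identityʳ a) (ℤₚ.+-identityʳ b) })
            }
          ; inverse = (λ { ⟨ a , b ⟩ → ⟨⟩-≡ (ℤₚ.+-inverseˡ a) (ℤₚ.+-inverseˡ b) })
                    , (λ { ⟨ a , b ⟩ → ⟨⟩-≡ (ℤₚ.+-inverseʳ a) (ℤₚ.+-inverseʳ b) })
          ; ⁻¹-cong = ≡.cong ⊖_
          }
        ; comm = λ { ⟨ a , b ⟩ ⟨ c , d ⟩ → ⟨⟩-≡ (ℤₚ.+-comm a c) (ℤₚ.+-comm b d) }
        }
      ; *-cong = ≡.cong₂ _⊗_
      ; *-assoc = λ { ⟨ a , b ⟩ ⟨ c , d ⟩ ⟨ e , f ⟩ → ⟨⟩-≡ (assoc₀ a b c d e f n) (assoc₁ a b c d e f n) }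
      ; *-identity = (λ { ⟨ a , b ⟩ → ⟨⟩-≡ (identityˡ₀ a b) (identityˡ₁ a b n) })
                   , (λ { ⟨ a , b ⟩ → ⟨⟩-≡ (identityʳ₀ a b) (identityʳ₁ a b n) })
      ; distrib = (λ { ⟨ a , b ⟩ ⟨ c , d ⟩ ⟨ e , f ⟩ → ⟨⟩-≡ (distribˡ₀ a b c d e f) (distribˡ₁ a b c d e f n) })
                , (λ { ⟨ a , b ⟩ ⟨ c , d ⟩ ⟨ e , f ⟩ → ⟨⟩-≡ (distribʳ₀ a b c d e f) (distribʳ₁ a b c d e f n) })
      }
    ; *-comm = λ { ⟨ a , b ⟩ ⟨ c , d ⟩ → ⟨⟩-≡ (comm₀ a b c d) (comm₁ a b c d n) }
    }
    where
    assoc₀ : ∀ a b c d e f n → (a * c - b * d) * e - (a * d + b * c + n * b * d) * f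
                              ≡ a * (c * e - d * f) - b * (c * f + d * e + n * d * f)
    assoc₀ = solve-∀
    assoc₁ : ∀ a b c d e f n → (a * c - b * d) * f + (a * d + b * c + n * b * d) * e + n * (a * d + b * c + n * b * d) * f
                              ≡ a * (c * f + d * e + n * d * f) + b * (c * e - d * f) + n * b * (c * f + d * e + n * d * f)
    assoc₁ = solve-∀
    identityˡ₀ : ∀ a b → 1ℤ * a - 0ℤ * b ≡ a
    identityˡ₀ = solve-∀
    identityˡ₁ : ∀ a b n → 1ℤ * b + 0ℤ * a + n * 0ℤ * b ≡ b
    identityˡ₁ = solve-∀
    identityʳ₀ : ∀ a b → a * 1ℤ - b * 0ℤ ≡ a
    identityʳ₀ = solve-∀
    identityʳ₁ : ∀ a b n → a * 0ℤ + b * 1ℤ + n * b * 0ℤ ≡ b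
    identityʳ₁ = solve-∀
    distribˡ₀ : ∀ a b c d e f → a * (c + e) - b * (d + f) ≡ (a * c - b * d) + (a * e - b * f)
    distribˡ₀ = solve-∀
    distribˡ₁ : ∀ a b c d e f n → a * (d + f) + b * (c + e) + n * b * (d + f)
                                 ≡ (a * d + b * c + n * b * d) + (a * f + b * e + n * b * f)
    distribˡ₁ = solve-∀
    distribʳ₀ : ∀ a b c d e f → (c + e) * a - (d + f) * b ≡ (c * a - d * b) + (e * a - f * b)
    distribʳ₀ = solve-∀
    distribʳ₁ : ∀ a b c d e f n → (c + e) * b + (d + f) * a + n * (d + f) * b
                                 ≡ (c * b + d * a + n * d * b) + (e * b + f * a + n * f * b)
    distribʳ₁ = solve-∀
    comm₀ : ∀ a b c d → a * c - b * d ≡ c * a - d * b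
    comm₀ = solve-∀
    comm₁ : ∀ a b c d n → a * d + b * c + n * b * d ≡ c * b + d * a + n * d * b
    comm₁ = solve-∀

  module _ {q : ℕ} where

    ≋ξ-isEquivalence : IsEquivalence (λ u v → u ≋ξ v [ q ])
    ≋ξ-isEquivalence = record
      { refl  = ≋-refl , ≋-refl
      ; sym   = λ (u₀≋v₀ , u₁≋v₁) → ≋-sym u₀≋v₀ , ≋-sym u₁≋v₁
      ; trans = λ (u₀≋v₀ , u₁≋v₁) (v₀≋w₀ , v₁≋w₁) → ≋-trans u₀≋v₀ v₀≋w₀ , ≋-trans u₁≋v₁ v₁≋w₁
      }

    ⊕-cong : Congruent₂ (λ u v → u ≋ξ v [ q ]) _⊕_
    ⊕-cong (a≋a′ , b≋b′) (c≋c′ , d≋d′) = +-cong-≋ a≋a′ c≋c′ , +-cong-≋ b≋b′ d≋d′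

    ⊗-cong : Congruent₂ (λ u v → u ≋ξ v [ q ]) _⊗_
    ⊗-cong (a≋a′ , b≋b′) (c≋c′ , d≋d′) =
      +-cong-≋ (*-cong-≋ a≋a′ c≋c′) (-‿cong-≋ (*-cong-≋ b≋b′ d≋d′)) ,
      +-cong-≋ (+-cong-≋ (*-cong-≋ a≋a′ d≋d′) (*-cong-≋ b≋b′ c≋c′)) (*-cong-≋ (*-cong-≋ (≋-refl {a = n}) b≋b′) d≋d′)

    ⊖-cong : Congruent₁ (λ u v → u ≋ξ v [ q ]) ⊖_
    ⊖-cong (a≋a′ , b≋b′) = -‿cong-≋ a≋a′ , -‿cong-≋ b≋b′

  ℤ[ξ]/_ : ℕ → CommutativeRing 0ℓ 0ℓ
  ℤ[ξ]/ q = Quotient.quotientRing isCommutativeRing (≋ξ-isEquivalence {q}) ⊕-cong ⊗-cong ⊖-cong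

  ℤ[ξ]-ring : CommutativeRing 0ℓ 0ℓ
  ℤ[ξ]-ring = record { isCommutativeRing = isCommutativeRing }

  open import Algebra.Properties.Semiring.Exp (CommutativeRing.semiring ℤ[ξ]-ring) using () renaming (_^_ to _^′_)

  s-shift : ∀ m k → s (k + + m) n ≡ c₀ (ξ ^′ m) * s k n + c₁ (ξ ^′ m) * s (+ 1 + k) n
  s-shift zero    k = ≡.trans (≡.cong (λ i → s i n) (ℤₚ.+-identityʳ k)) (eq (s k n) (s (+ 1 + k) n))
    where eq : ∀ x y → x ≡ 1ℤ * x + 0ℤ * y
          eq = solve-∀
  s-shift (suc m) k = begin
    s (k + + suc m) n                                        ≡⟨ ≡.cong (λ i → s i n) (shift k (+ m)) ⟩
    s (+ 1 + k + + m) n                                      ≡⟨ s-shift m (+ 1 + k) ⟩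
    a * s (+ 1 + k) n + b * s (+ 1 + (+ 1 + k)) n            ≡⟨ ≡.cong (λ x → a * s (+ 1 + k) n + b * x) next ⟩
    a * s (+ 1 + k) n + b * (n * s (+ 1 + k) n - s k n)      ≡⟨ eq a b n (s k n) (s (+ 1 + k) n) ⟩
    c₀ (ξ ^′ suc m) * s k n + c₁ (ξ ^′ suc m) * s (+ 1 + k) n ∎
    where
    open ≡.≡-Reasoning
    a b : ℤ
    a = c₀ (ξ ^′ m)
    b = c₁ (ξ ^′ m)
    shift : ∀ k i → k + (+ 1 + i) ≡ + 1 + k + i
    shift = solve-∀
    next : s (+ 1 + (+ 1 + k)) n ≡ n * s (+ 1 + k) n - s k n
    next = ≡.trans (≡.cong (λ i → s i n) (≡.sym (ℤₚ.+-assoc (+ 1) (+ 1) k))) (s-rec n k)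
    eq : ∀ a b n x y → a * y + b * (n * y - x) ≡ (0ℤ * a - 1ℤ * b) * x + (0ℤ * b + 1ℤ * a + n * 1ℤ * b) * y
    eq = solve-∀

  ξ^≋𝟙⇒periodic : ∀ {q P} → ξ ^′ P ≋ξ 𝟙 [ q ] → Periodic q (λ k → s k n) P
  ξ^≋𝟙⇒periodic {q} {P} (a≋1 , b≋0) k =
    ≋-trans (≋-reflexive (s-shift P k))
      (≋-trans (+-cong-≋ (*-cong-≋ a≋1 (≋-refl {a = s k n})) (*-cong-≋ b≋0 (≋-refl {a = s (+ 1 + k) n})))
               (≋-reflexive (eq (s k n) (s (+ 1 + k) n))))
    where eq : ∀ x y → 1ℤ * x + 0ℤ * y ≡ x
          eq = solve-∀

module PowersOfξ (n : ℤ) {m : ℕ} (prime : Prime (suc (2 ℕ.* m))) where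

  open Quadratic n

  private
    q : ℕ
    q = suc (2 ℕ.* m)

  open CommutativeRing (ℤ[ξ]/ q)
    using (_≈_; setoid; semiring; commutativeSemiring; reflexive; sym; trans;
           *-congˡ; *-congʳ; +-congˡ; +-cong; *-assoc; *-comm; *-identityˡ; *-identityʳ)
  open import Algebra.Properties.Semiring.Mult semiring using () renaming (_×_ to _×ᴿ_)
  open import Algebra.Properties.Semiring.Exp semiring using (^-congˡ; ^-assocʳ) renaming (_^_ to _^ᴿ_)
  open import Algebra.Properties.CommutativeSemiring.Exp commutativeSemiring using (^-distrib-*)
  open import Relation.Binary.Reasoning.Setoid setoid
  open Frobenius (ℤ[ξ]/ q) prime using (frobenius)

  ι : ℤ → ℤ[ξ]
  ι a = ⟨ a , 0ℤ ⟩

  D : ℤ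
  D = n * n - + 4

  -- ξ⁻¹ = n - ξ, and δ = 2 ξ - n is a square root of D.
  ξ⁻¹ δ : ℤ[ξ]
  ξ⁻¹ = ⟨ n , -1ℤ ⟩
  δ   = ⟨ - n , + 2 ⟩

  ι-cong : ∀ {a b} → a ≋ b [ q ] → ι a ≈ ι b
  ι-cong a≋b = a≋b , ≋-refl

  ι-⊗ : ∀ a b → ι a ⊗ ι b ≈ ι (a * b)
  ι-⊗ a b = reflexive (⟨⟩-≡ (eq₀ a b) (eq₁ a b n))
    where eq₀ : ∀ a b → a * b - 0ℤ * 0ℤ ≡ a * b
          eq₀ = solve-∀
          eq₁ : ∀ a b n → a * 0ℤ + 0ℤ * b + n * 0ℤ * 0ℤ ≡ 0ℤ
          eq₁ = solve-∀

  ι-^ : ∀ a k → ι a ^ᴿ k ≈ ι (a ^ k)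
  ι-^ a zero    = reflexive refl
  ι-^ a (suc k) = trans (*-congˡ {ι a} (ι-^ a k)) (ι-⊗ a (a ^ k))

  ι-fermat : ∀ a → ι a ^ᴿ q ≈ ι a
  ι-fermat a = trans (ι-^ a q) (ι-cong (Fermat.fermat prime a))

  ×𝟙≡ι : ∀ k → k ×ᴿ 𝟙 ≡ ι (+ k)
  ×𝟙≡ι zero    = refl
  ×𝟙≡ι (suc k) = ≡.cong (𝟙 ⊕_) (×𝟙≡ι k)

  char : q ×ᴿ 𝟙 ≈ 𝟘
  char = trans (reflexive (×𝟙≡ι q)) (ι-cong (∣⇒≋0 ∣-refl))

  ι2⊗ξ≈ιn⊕δ : ι (+ 2) ⊗ ξ ≈ ι n ⊕ δ
  ι2⊗ξ≈ιn⊕δ = reflexive (⟨⟩-≡ (eq₀ n) (eq₁ n))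
    where eq₀ : ∀ n → + 2 * 0ℤ - 0ℤ * 1ℤ ≡ n + - n
          eq₀ = solve-∀
          eq₁ : ∀ n → + 2 * 1ℤ + 0ℤ * 0ℤ + n * 0ℤ * 1ℤ ≡ 0ℤ + + 2
          eq₁ = solve-∀

  δ⊗δ≈ιD : δ ⊗ δ ≈ ι D
  δ⊗δ≈ιD = reflexive (⟨⟩-≡ (eq₀ n) (eq₁ n))
    where eq₀ : ∀ n → - n * - n - + 2 * + 2 ≡ n * n - + 4
          eq₀ = solve-∀
          eq₁ : ∀ n → - n * + 2 + + 2 * - n + n * + 2 * + 2 ≡ 0ℤ
          eq₁ = solve-∀

  ξ⊗ξ⁻¹≈𝟙 : ξ ⊗ ξ⁻¹ ≈ 𝟙
  ξ⊗ξ⁻¹≈𝟙 = reflexive (⟨⟩-≡ (eq₀ n) (eq₁ n))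
    where eq₀ : ∀ n → 0ℤ * n - 1ℤ * -1ℤ ≡ 1ℤ
          eq₀ = solve-∀
          eq₁ : ∀ n → 0ℤ * -1ℤ + 1ℤ * n + n * 1ℤ * -1ℤ ≡ 0ℤ
          eq₁ = solve-∀

  ι2⊗-cancel : ∀ {u v} → ι (+ 2) ⊗ u ≈ ι (+ 2) ⊗ v → u ≈ v
  ι2⊗-cancel {⟨ a , b ⟩} {⟨ c , d ⟩} (≋₀ , ≋₁) =
    *-cancelˡ-≋ prime (+ 2) q∤2 (≋-trans (≋-reflexive (≡.sym (eq₀ a b))) (≋-trans ≋₀ (≋-reflexive (eq₀ c d)))) ,
    *-cancelˡ-≋ prime (+ 2) q∤2 (≋-trans (≋-reflexive (≡.sym (eq₁ a b n))) (≋-trans ≋₁ (≋-reflexive (eq₁ c d n))))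
    where
    q∤2 : ¬ (+ q ∣ + 2)
    q∤2 = 0<k<q⇒q∤k (s≤s z≤n) (2<q {m} prime)
    eq₀ : ∀ a b → + 2 * a - 0ℤ * b ≡ + 2 * a
    eq₀ = solve-∀
    eq₁ : ∀ a b n → + 2 * b + 0ℤ * a + n * 0ℤ * b ≡ + 2 * b
    eq₁ = solve-∀

  module _ {ε : ℤ} (D^m≋ε : D ^ m ≋ ε [ q ]) where

    δ^q≈δ⊗ιε : δ ^ᴿ q ≈ δ ⊗ ι ε
    δ^q≈δ⊗ιε = *-congˡ {δ} (begin
      δ ^ᴿ (2 ℕ.* m)   ≈⟨ ^-assocʳ δ 2 m ⟨
      (δ ^ᴿ 2) ^ᴿ m     ≈⟨ ^-congˡ m (*-congˡ {δ} (*-identityʳ δ)) ⟩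
      (δ ⊗ δ) ^ᴿ m     ≈⟨ ^-congˡ m δ⊗δ≈ιD ⟩
      ι D ^ᴿ m         ≈⟨ ι-^ D m ⟩
      ι (D ^ m)     ≈⟨ ι-cong D^m≋ε ⟩
      ι ε             ∎)

    ι2⊗ξ^q≈ιn⊕δ⊗ιε : ι (+ 2) ⊗ ξ ^ᴿ q ≈ ι n ⊕ δ ⊗ ι ε
    ι2⊗ξ^q≈ιn⊕δ⊗ιε = begin
      ι (+ 2) ⊗ ξ ^ᴿ q        ≈⟨ *-congʳ (ι-fermat (+ 2)) ⟨
      ι (+ 2) ^ᴿ q ⊗ ξ ^ᴿ q    ≈⟨ ^-distrib-* (ι (+ 2)) ξ q ⟨
      (ι (+ 2) ⊗ ξ) ^ᴿ q      ≈⟨ ^-congˡ q ι2⊗ξ≈ιn⊕δ ⟩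
      (ι n ⊕ δ) ^ᴿ q          ≈⟨ frobenius char (ι n) δ ⟩
      ι n ^ᴿ q ⊕ δ ^ᴿ q        ≈⟨ +-cong (ι-fermat n) δ^q≈δ⊗ιε ⟩
      ι n ⊕ δ ⊗ ι ε          ∎

  ξ^[q∸1]≈𝟙 : D ^ m ≋ 1ℤ [ q ] → ξ ^ᴿ (2 ℕ.* m) ≈ 𝟙
  ξ^[q∸1]≈𝟙 D^m≋1 = begin
    ξ ^ᴿ (2 ℕ.* m)                ≈⟨ *-identityˡ _ ⟨
    𝟙 ⊗ ξ ^ᴿ (2 ℕ.* m)            ≈⟨ *-congʳ ξ⁻¹⊗ξ≈𝟙 ⟨
    ξ⁻¹ ⊗ ξ ⊗ ξ ^ᴿ (2 ℕ.* m)      ≈⟨ *-assoc ξ⁻¹ ξ _ ⟩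
    ξ⁻¹ ⊗ ξ ^ᴿ q                  ≈⟨ *-congˡ {ξ⁻¹} ξ^q≈ξ ⟩
    ξ⁻¹ ⊗ ξ                      ≈⟨ ξ⁻¹⊗ξ≈𝟙 ⟩
    𝟙                            ∎
    where
    ξ⁻¹⊗ξ≈𝟙 : ξ⁻¹ ⊗ ξ ≈ 𝟙
    ξ⁻¹⊗ξ≈𝟙 = trans (*-comm ξ⁻¹ ξ) ξ⊗ξ⁻¹≈𝟙
    ξ^q≈ξ : ξ ^ᴿ q ≈ ξ
    ξ^q≈ξ = ι2⊗-cancel (begin
      ι (+ 2) ⊗ ξ ^ᴿ q    ≈⟨ ι2⊗ξ^q≈ιn⊕δ⊗ιε D^m≋1 ⟩
      ι n ⊕ δ ⊗ 𝟙        ≈⟨ +-congˡ {ι n} (*-identityʳ δ) ⟩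
      ι n ⊕ δ            ≈⟨ ι2⊗ξ≈ιn⊕δ ⟨
      ι (+ 2) ⊗ ξ        ∎)

  ξ^[q+1]≈𝟙 : D ^ m ≋ -1ℤ [ q ] → ξ ^ᴿ suc q ≈ 𝟙
  ξ^[q+1]≈𝟙 D^m≋-1 = trans (*-congˡ {ξ} ξ^q≈ξ⁻¹) ξ⊗ξ⁻¹≈𝟙
    where
    ιn⊕δ⊗ι-1≡ι2⊗ξ⁻¹ : ι n ⊕ δ ⊗ ι -1ℤ ≡ ι (+ 2) ⊗ ξ⁻¹
    ιn⊕δ⊗ι-1≡ι2⊗ξ⁻¹ = ⟨⟩-≡ (eq₀ n) (eq₁ n)
      where eq₀ : ∀ n → n + (- n * -1ℤ - + 2 * 0ℤ) ≡ + 2 * n - 0ℤ * -1ℤ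
            eq₀ = solve-∀
            eq₁ : ∀ n → 0ℤ + (- n * 0ℤ + + 2 * -1ℤ + n * + 2 * 0ℤ) ≡ + 2 * -1ℤ + 0ℤ * n + n * 0ℤ * -1ℤ
            eq₁ = solve-∀
    ξ^q≈ξ⁻¹ : ξ ^ᴿ q ≈ ξ⁻¹
    ξ^q≈ξ⁻¹ = ι2⊗-cancel (trans (ι2⊗ξ^q≈ιn⊕δ⊗ιε D^m≋-1) (reflexive ιn⊕δ⊗ι-1≡ι2⊗ξ⁻¹))

  ξ^ᴿ≈𝟙⇒periodic : ∀ {P} → ξ ^ᴿ P ≈ 𝟙 → Periodic q (λ k → s k n) P
  ξ^ᴿ≈𝟙⇒periodic {P} =
    ξ^≋𝟙⇒periodic ∘
    ≡.subst (λ u → u ≋ξ 𝟙 [ q ]) (Quotient.^-≡ isCommutativeRing ≋ξ-isEquivalence ⊕-cong ⊗-cong ⊖-cong ξ P)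

-- Odd primes

odd-prime : ∀ {q} → Prime q → q ≢ 2 → ∃ λ m → q ≡ suc (2 ℕ.* m)
odd-prime {q} q-prime q≢2 = by-remainder (q % 2) (m%n<n q 2) refl
  where
  by-remainder : ∀ r → r ℕ.< 2 → q % 2 ≡ r → ∃ λ m → q ≡ suc (2 ℕ.* m)
  by-remainder 0 _ q%2≡0 with prime⇒irreducible q-prime (ℕ.m%n≡0⇒n∣m q 2 q%2≡0)
  ... | inj₁ ()
  ... | inj₂ 2≡q = ⊥-elim (q≢2 (≡.sym 2≡q))
  by-remainder 1 _ q%2≡1 = q / 2 , ≡.trans (m≡m%n+[m/n]*n q 2) (≡.cong₂ ℕ._+_ q%2≡1 (ℕ.*-comm (q / 2) 2))
  by-remainder (suc (suc _)) (s≤s (s≤s ())) _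

negOnePow-suc : ∀ k → negOnePow (+ 1 + k) ≡ - negOnePow k
negOnePow-suc (+ j)            = ℤₚ.-1*i≡-i (-1ℤ ^ j)
negOnePow-suc -[1+ zero ]      = refl
negOnePow-suc -[1+ suc j ]     = eq (-1ℤ ^ suc j)
  where eq : ∀ a → a ≡ - (-1ℤ * a)
        eq = solve-∀

negOnePow-2+ : ∀ k → negOnePow (+ 2 + k) ≡ negOnePow k
negOnePow-2+ k = begin
  negOnePow (+ 2 + k)           ≡⟨ ≡.cong negOnePow (ℤₚ.+-assoc (+ 1) (+ 1) k) ⟩
  negOnePow (+ 1 + (+ 1 + k))   ≡⟨ negOnePow-suc (+ 1 + k) ⟩
  - negOnePow (+ 1 + k)         ≡⟨ ≡.cong -_ (negOnePow-suc k) ⟩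
  - - negOnePow k               ≡⟨ ℤₚ.neg-involutive (negOnePow k) ⟩
  negOnePow k                   ∎
  where open ≡.≡-Reasoning

OddPrimeCases : ℤ → ℕ → Set
OddPrimeCases n q =
  (Legendre (n * n - + 4) q 1ℤ × Σ ℕ (λ p → LeastPeriod n q p × p ℕ.∣ (q ∸ 1)))
  ⊎ (Legendre (n * n - + 4) q -1ℤ × Σ ℕ (λ p → LeastPeriod n q p × p ℕ.∣ (q ℕ.+ 1)))
  ⊎ (n ≡ + 2 [mod q ] × LeastPeriod n q q × (∀ k → (s k n ≡ 0ℤ [mod q ] ⇔ (+ q) Unsigned.∣ (+ 2 * k + + 1))))
  ⊎ (n ≡ - (+ 2) [mod q ] × LeastPeriod n q 2 × (∀ k → s k n ≡ negOnePow k [mod q ]))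

module OddPrime (n : ℤ) {m : ℕ} (prime : Prime (suc (2 ℕ.* m))) where

  private
    q : ℕ
    q = suc (2 ℕ.* m)

    D : ℤ
    D = n * n - + 4

    sₙ : ℤ → ℤ
    sₙ k = s k n

  open PowersOfξ n {m} prime using (ξ^[q∸1]≈𝟙; ξ^[q+1]≈𝟙; ξ^ᴿ≈𝟙⇒periodic)

  residue-case : ¬ (+ q ∣ D) → (∃ λ y → y * y ≋ D [ q ]) →
    Legendre D q 1ℤ × Σ ℕ (λ p → LeastPeriod n q p × p ℕ.∣ (q ∸ 1))
  residue-case q∤D (y , y²≋D) = residue (q∤D ∘ ∣ᵤ⇒∣) (y , toMod y²≋D) , L , least , least-period-∣ least periodic
    where
    q∤y : ¬ (+ q ∣ y)
    q∤y q∣y = q∤D (≋0⇒∣ (≋-trans (≋-sym y²≋D) (*-cong-≋ (∣⇒≋0 q∣y) (≋-refl {a = y}))))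
    D^m≋1 : D ^ m ≋ 1ℤ [ q ]
    D^m≋1 = ≋-trans (^-cong-≋ m (≋-sym y²≋D)) (Euler.square^m≋1 {m} prime y q∤y)
    periodic : Periodic q sₙ (2 ℕ.* m)
    periodic = ξ^ᴿ≈𝟙⇒periodic (ξ^[q∸1]≈𝟙 D^m≋1)
    L : ℕ
    L = proj₁ (least-period-exists (ℕ.*-monoʳ-< 2 (0<m {m} prime)) periodic)
    least : LeastPeriod n q L
    least = proj₂ (least-period-exists (ℕ.*-monoʳ-< 2 (0<m {m} prime)) periodic)

  nonresidue-case : ¬ (+ q ∣ D) → (∀ y → ¬ (y * y ≋ D [ q ])) →
    Legendre D q -1ℤ × Σ ℕ (λ p → LeastPeriod n q p × p ℕ.∣ (q ℕ.+ 1))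
  nonresidue-case q∤D nonresidue =
    nonres (q∤D ∘ ∣ᵤ⇒∣) (λ y → nonresidue y ∘ fromMod) , L , least ,
    ≡.subst (L ℕ.∣_) (ℕ.+-comm 1 q) (least-period-∣ least periodic)
    where
    periodic : Periodic q sₙ (suc q)
    periodic = ξ^ᴿ≈𝟙⇒periodic (ξ^[q+1]≈𝟙 (Euler.euler-nonresidue {m} prime D nonresidue))
    L : ℕ
    L = proj₁ (least-period-exists (s≤s z≤n) periodic)
    least : LeastPeriod n q L
    least = proj₂ (least-period-exists (s≤s z≤n) periodic)

  n≡2-case : n ≋ + 2 [ q ] →
    n ≡ + 2 [mod q ] × LeastPeriod n q q × (∀ k → (s k n ≡ 0ℤ [mod q ] ⇔ (+ q) Unsigned.∣ (+ 2 * k + + 1)))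
  n≡2-case n≋2 = toMod n≋2 , (periodic⇒isPeriod (ℕ.<-trans (s≤s z≤n) (2<q {m} prime)) periodic , least) ,
    λ k → mk⇔ (∣⇒∣ᵤ ∘ ≋0⇒∣ ∘ ≋-trans (≋-sym (s≋2k+1 k)) ∘ fromMod)
              (toMod ∘ ≋-trans (s≋2k+1 k) ∘ ∣⇒≋0 ∘ ∣ᵤ⇒∣)
    where
    2k+1 : ℤ → ℤ
    2k+1 k = + 2 * k + + 1
    2k+1-recurrent : Recurrent (+ 2) 2k+1
    2k+1-recurrent k = ≋-reflexive (eq k)
      where eq : ∀ k → + 2 * (+ 2 + k) + + 1 ≡ + 2 * (+ 2 * (+ 1 + k) + + 1) - (+ 2 * k + + 1)
            eq = solve-∀
    s≋2k+1 : ∀ k → s k n ≋ 2k+1 k [ q ]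
    s≋2k+1 = recurrent-unique (+ 2) (s-recurrent n≋2) 2k+1-recurrent ≋-refl (+-cong-≋ n≋2 ≋-refl)
    periodic : Periodic q sₙ q
    periodic k = ≋-trans (s≋2k+1 (k + + q)) (≋-trans (mod⁺ (∣-resp-≡ (eq k (+ q)) (∣q* (+ 2)))) (≋-sym (s≋2k+1 k)))
      where eq : ∀ k x → x * + 2 ≡ + 2 * (k + x) + + 1 - (+ 2 * k + + 1)
            eq = solve-∀
    least : ∀ p → IsPeriod n q p → q ℕ.≤ p
    least p (0<p , per) = ℕ.≮⇒≥ λ p<q → q∤2p p<q (≋0⇒∣ 2p≋0)
      where
      eq : ∀ x → + 2 * x ≡ (+ 2 * x + + 1) - + 1
      eq = solve-∀
      2p≋0 : + 2 * + p ≋ 0ℤ [ q ]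
      2p≋0 = ≋-trans (≋-reflexive (eq (+ p)))
        (+-cong-≋ (≋-trans (≋-sym (s≋2k+1 (+ p))) (≋-trans (fromMod (per 0ℤ)) (s≋2k+1 0ℤ))) ≋-refl)
      q∤2p : p ℕ.< q → ¬ (+ q ∣ + 2 * + p)
      q∤2p p<q q∣2p with ∣-*⇒∣⊎∣ prime (+ 2) (+ p) q∣2p
      ... | inj₁ q∣2 = 0<k<q⇒q∤k (s≤s z≤n) (2<q {m} prime) q∣2
      ... | inj₂ q∣p = 0<k<q⇒q∤k 0<p p<q q∣p

  n≡-2-case : n ≋ - + 2 [ q ] →
    n ≡ - (+ 2) [mod q ] × LeastPeriod n q 2 × (∀ k → s k n ≡ negOnePow k [mod q ])
  n≡-2-case n≋-2 = toMod n≋-2 , (periodic⇒isPeriod (s≤s z≤n) periodic , least) , toMod ∘ s≋±1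
    where
    negOnePow-recurrent : Recurrent (- + 2) negOnePow
    negOnePow-recurrent k = ≋-reflexive (begin
      negOnePow (+ 2 + k)                               ≡⟨ negOnePow-2+ k ⟩
      negOnePow k                                       ≡⟨ eq (negOnePow k) ⟩
      - + 2 * - negOnePow k - negOnePow k               ≡⟨ ≡.cong (λ x → - + 2 * x - negOnePow k) (negOnePow-suc k) ⟨
      - + 2 * negOnePow (+ 1 + k) - negOnePow k         ∎)
      where open ≡.≡-Reasoning
            eq : ∀ a → a ≡ - + 2 * - a - a
            eq = solve-∀
    s≋±1 : ∀ k → s k n ≋ negOnePow k [ q ]
    s≋±1 = recurrent-unique (- + 2) (s-recurrent n≋-2) negOnePow-recurrent ≋-refl (+-cong-≋ n≋-2 ≋-refl)
    periodic : Periodic q sₙ 2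
    periodic k = ≋-trans (s≋±1 (k + + 2))
      (≋-trans (≋-reflexive (≡.trans (≡.cong negOnePow (ℤₚ.+-comm k (+ 2))) (negOnePow-2+ k))) (≋-sym (s≋±1 k)))
    least : ∀ p → IsPeriod n q p → 2 ℕ.≤ p
    least zero          (() , _)
    least (suc zero)    (_ , per) = ⊥-elim (0<k<q⇒q∤k (s≤s z≤n) (2<q {m} prime) (∣m⇒∣-m {m = -1ℤ - 1ℤ}
      (mod⁻ (≋-trans (≋-sym (s≋±1 1ℤ)) (≋-trans (fromMod (per 0ℤ)) (s≋±1 0ℤ))))))
    least (suc (suc _)) _         = s≤s (s≤s z≤n)

  residue? : (∃ λ y → y * y ≋ D [ q ]) ⊎ (∀ y → ¬ (y * y ≋ D [ q ]))
  residue? with any? (λ (i : Fin q) → ≋-dec q (+ toℕ i * + toℕ i) D)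
  ... | yes (i , i²≋D) = inj₁ (+ toℕ i , i²≋D)
  ... | no ∄i = inj₂ λ y y²≋D → ∄i (fromℕ< (n%ℕd<d y q) ,
    ≡.subst (λ r → + r * + r ≋ D [ q ]) (≡.sym (toℕ-fromℕ< (n%ℕd<d y q)))
      (≋-trans (*-cong-≋ (≋-sym (≋-%ℕ y)) (≋-sym (≋-%ℕ y))) y²≋D))

  classification : OddPrimeCases n q
  classification with ≋-dec q D 0ℤ
  ... | no D≉0  = Sum.map (residue-case q∤D) (inj₁ ∘ nonresidue-case q∤D) residue?
    where q∤D : ¬ (+ q ∣ D)
          q∤D = D≉0 ∘ ∣⇒≋0
  ... | yes D≋0 = inj₂ (inj₂ (Sum.map (n≡2-case ∘ mod⁺) (n≡-2-case ∘ mod⁺)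
                   (∣-*⇒∣⊎∣ prime (n - + 2) (n + + 2) (∣-resp-≡ (eq n) (≋0⇒∣ D≋0)))))
    where eq : ∀ n → n * n - + 4 ≡ (n - + 2) * (n + + 2)
          eq = solve-∀

lemma32 : (n : ℤ) → + 2 ≤ n →
  ((LeastPeriod n 2 3 ⇔ (¬ ((+ 2) Unsigned.∣ n)))
    × (¬ ((+ 2) Unsigned.∣ n) → ∀ (k : ℤ) → ((+ 2) Unsigned.∣ s k n ⇔ k ≡ + 1 [mod 3 ]))
    × ((+ 2) Unsigned.∣ n → LeastPeriod n 2 1 × (∀ (k : ℤ) → ¬ ((+ 2) Unsigned.∣ s k n))))
  × (∀ (q : ℕ) → Prime q → q ≢ 2 →
      (Legendre (n * n - + 4) q 1ℤ × Σ ℕ (λ p → LeastPeriod n q p × p ℕ.∣ (q ∸ 1)))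
      ⊎ (Legendre (n * n - + 4) q -1ℤ × Σ ℕ (λ p → LeastPeriod n q p × p ℕ.∣ (q ℕ.+ 1)))
      ⊎ (n ≡ + 2 [mod q ] × LeastPeriod n q q
          × (∀ (k : ℤ) → (s k n ≡ 0ℤ [mod q ] ⇔ (+ q) Unsigned.∣ (+ 2 * k + + 1))))
      ⊎ (n ≡ - (+ 2) [mod q ] × LeastPeriod n q 2
          × (∀ (k : ℤ) → s k n ≡ negOnePow k [mod q ])))
lemma32 n _ = Parity.parity n , odd-case
  where
  odd-case : ∀ q → Prime q → q ≢ 2 → OddPrimeCases n q
  odd-case q q-prime q≢2 with odd-prime q-prime q≢2
  ... | m , refl = OddPrime.classification n {m} q-prime
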